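{- For every $n\ge 6$, $D_n(x)=xD_{n-1}(x)+xD_{n-2}(x)+(x-x^2)D_{n-3}(x)$.
   Context: For $n\ge 0$, the $S$-fence $\phi_n$ is the poset on $\{x_1,\dots,x_n\}$ whose order is generated by the cover relations $x_2<x_1$, $x_3<x_2$, $x_2<x_4$, $x_5<x_4$, and, for every $i\ge 3$, $x_{2i-1}<x_{2i}$ and $x_{2i+1}<x_{2i}$, keeping only those relations whose elements both have index $\le n$. A filter is an up-set. $\Phi_n$ is the underlying undirected graph of the Hasse diagram of the lattice of filters of $\phi_n$ ordered by reverse inclusion (two filters adjacent iff they differ in exactly one element). $d_{n,k}$ is the number of vertices of $\Phi_n$ of degree $k$, and $D_n(x)=\sum_{k\ge0}d_{n,k}x^k$ is the degree sequence polynomial. -}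

module Defs where

open import Data.Bool using (Bool; true; false; _∧_; _∨_; not; if_then_else_)
open import Data.Nat using (ℕ; zero; suc; _+_; _∸_; _≡ᵇ_)
open import Data.Integer as ℤ using (ℤ; +_)
open import Data.List using (List; []; _∷_; map; length; filter; upTo; _++_; concatMap)
open import Relation.Nullary.Decidable using (Dec; yes; no)
open import Relation.Binary.PropositionalEquality using (_≡_)

-- Elements of φ_n are x_1,…,x_n, represented by their indices 1..n.
indices : ℕ → List ℕ
indices n = map suc (upTo n)

-- cover a b = true  iff  x_a < x_b is one of the generating cover relations of the S-fence:
--   x2<x1, x3<x2, x2<x4, x5<x4, and for i ≥ 3: x_{2i-1}<x_{2i}, x_{2i+1}<x_{2i}.
isEven : ℕ → Bool
isEven zero = true
isEven (suc zero) = false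
isEven (suc (suc n)) = isEven n

atLeast6 : ℕ → Bool
atLeast6 (suc (suc (suc (suc (suc (suc _)))))) = true
atLeast6 _ = false

cover : ℕ → ℕ → Bool
cover a b =
  ((a ≡ᵇ 2) ∧ (b ≡ᵇ 1)) ∨ ((a ≡ᵇ 3) ∧ (b ≡ᵇ 2)) ∨ ((a ≡ᵇ 2) ∧ (b ≡ᵇ 4)) ∨ ((a ≡ᵇ 5) ∧ (b ≡ᵇ 4))
  ∨ (isEven b ∧ atLeast6 b ∧ (((a + 1) ≡ᵇ b) ∨ (a ≡ᵇ (b + 1))))

allB : {A : Set} → (A → Bool) → List A → Bool
allB p [] = true
allB p (x ∷ xs) = p x ∧ allB p xs

-- A subset of {x_1,…,x_n} is a list of n booleans; entry i (1-based) says whether x_i is in it.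
Subset : Set
Subset = List Bool

subsets : ℕ → List Subset
subsets zero = [] ∷ []
subsets (suc n) = concatMap (λ s → (true ∷ s) ∷ (false ∷ s) ∷ []) (subsets n)

-- membership of x_i (1-based; false outside range)
mem : Subset → ℕ → Bool
mem [] _ = false
mem (b ∷ s) zero = false
mem (b ∷ s) (suc zero) = b
mem (b ∷ s) (suc (suc i)) = mem s (suc i)

toggle : Subset → ℕ → Subset
toggle [] _ = []
toggle (b ∷ s) zero = b ∷ s
toggle (b ∷ s) (suc zero) = not b ∷ s
toggle (b ∷ s) (suc (suc i)) = b ∷ toggle s (suc i)

-- U is a filter (up-set) of φ_n: closed upward along every cover relation x_a < x_b
-- with a, b ≤ n (hence along the generated order).
isFilter : ℕ → Subset → Bool
isFilter n U =
  allB (λ a → allB (λ b → not (cover a b ∧ mem U a ∧ not (mem U b))) (indices n)) (indices n)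

count : {A : Set} → (A → Bool) → List A → ℕ
count p xs = length (filter (λ x → Data.Bool._≟_ (p x) true) xs)
  where import Data.Bool

-- degree of filter U in Φ_n: number of filters differing from U in exactly one element
degree : ℕ → Subset → ℕ
degree n U = count (λ i → isFilter n (toggle U i)) (indices n)

filters : ℕ → List Subset
filters n = filter (λ U → Data.Bool._≟_ (isFilter n U) true) (subsets n)
  where import Data.Bool

d : ℕ → ℕ → ℕ
d n k = count (λ U → degree n U ≡ᵇ k) (filters n)

-- Polynomials with integer coefficients, as coefficient sequences (coefficient of x^k).
Poly : Set
Poly = ℕ → ℤ

_⊕_ : Poly → Poly → Poly
(p ⊕ q) k = p k ℤ.+ q k

_⊖_ : Poly → Poly → Poly
(p ⊖ q) k = p k ℤ.- q k

x· : Poly → Poly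
x· p zero = + 0
x· p (suc k) = p k

D : ℕ → Poly
D n k = + d n k

-- For n ≥ 5 the element x_{n+1} of the S-fence is related to x_n only, so a filter of φ_{n+1} is a
-- filter of φ_n together with a choice for x_{n+1}.  Call the top x_n of a filter pinned when its
-- membership forces that of x_{n+1}; then a filter extends by an unpinned top always and by a
-- pinned one exactly when its own top is unpinned, whatever the parity of n.  The degree of the
-- extension only depends on whether x_n is pinned, whether x_n may be toggled, and the degree, so
-- the degree polynomials of the four classes of filters evolve by one 4 × 4 transfer matrix over
-- ℤ[x].  Its characteristic polynomial is λ (λ³ − x λ² − x λ − (x − x²)), and Cayley–Hamilton gives
-- the recurrence for n ≥ 8; the cases n = 6, 7 are evaluated.

module Submission where

open import Defs
open import Data.Bool using (Bool; true; false; _∧_; _∨_; not; _xor_; if_then_else_)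
open import Data.Bool.Properties using (∧-assoc; ∧-commutativeMonoid; ∧-identityʳ; ∧-zeroʳ; ∨-zeroʳ; not-involutive; not-distribʳ-xor)
open import Data.Empty using (⊥-elim)
open import Data.Product using (_×_; _,_; proj₁; proj₂)
open import Data.Unit using (tt)
open import Data.List using (List; []; _∷_; _++_; [_]; _∷ʳ_; map; filter; length; upTo; concatMap)
open import Data.List.Properties using (map-++; upTo-∷ʳ)
open import Data.Nat using (ℕ; zero; suc; _+_; _∸_; _≡ᵇ_; _≤_; _<_; z≤n; s≤s)
open import Data.Nat.Tactic.RingSolver using (solve)
open import Data.Integer as ℤ using (+_)
import Data.Integer.Properties as ℤP
import Data.Integer.Tactic.RingSolver as ℤSolver
open import Data.Nat.Properties
  using (+-commutativeSemigroup; +-assoc; +-comm; +-identityʳ; ≤-refl; ≤-trans; m≤m+n; m≤n⇒m≤1+n; <⇒≢; >⇒≢; ≡ᵇ⇒≡)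
open import Relation.Binary.PropositionalEquality
  using (_≡_; _≢_; refl; sym; trans; cong; cong₂; subst; module ≡-Reasoning)
open import Algebra.Bundles using (CommutativeMonoid)
open import Algebra.Properties.CommutativeSemigroup +-commutativeSemigroup using (interchange)
open import Algebra.Properties.CommutativeSemigroup (CommutativeMonoid.commutativeSemigroup ∧-commutativeMonoid)
  using () renaming (interchange to ∧-interchange)
open ≡-Reasoning

bit : Bool → ℕ
bit true  = 1
bit false = 0

∑ : {A : Set} → List A → (A → ℕ) → ℕ
∑ []       f = 0
∑ (x ∷ xs) f = f x + ∑ xs f

syntax ∑ xs (λ x → f) = ∑[ x ∈ xs ] f

private variable
  A B : Set

∑-cong : ∀ (xs : List A) {f g : A → ℕ} → (∀ x → f x ≡ g x) → ∑ xs f ≡ ∑ xs g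
∑-cong []       f≗g = refl
∑-cong (x ∷ xs) f≗g = cong₂ _+_ (f≗g x) (∑-cong xs f≗g)

∑-++ : ∀ (xs ys : List A) (f : A → ℕ) → ∑ (xs ++ ys) f ≡ ∑ xs f + ∑ ys f
∑-++ []       ys f = refl
∑-++ (x ∷ xs) ys f = trans (cong (_+_ (f x)) (∑-++ xs ys f)) (sym (+-assoc (f x) _ _))

∑-+ : ∀ (xs : List A) (f g : A → ℕ) → ∑[ x ∈ xs ] (f x + g x) ≡ ∑ xs f + ∑ xs g
∑-+ []       f g = refl
∑-+ (x ∷ xs) f g =
  trans (cong (_+_ (f x + g x)) (∑-+ xs f g)) (interchange (f x) (g x) (∑ xs f) (∑ xs g))

∑-zero : ∀ (xs : List A) → ∑[ x ∈ xs ] 0 ≡ 0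
∑-zero []       = refl
∑-zero (x ∷ xs) = ∑-zero xs

∑-concatMap : ∀ (g : A → List B) (xs : List A) (f : B → ℕ) →
              ∑ (concatMap g xs) f ≡ ∑[ x ∈ xs ] ∑ (g x) f
∑-concatMap g []       f = refl
∑-concatMap g (x ∷ xs) f = trans (∑-++ (g x) _ f) (cong (_+_ (∑ (g x) f)) (∑-concatMap g xs f))

count-∑ : ∀ (p : A → Bool) xs → count p xs ≡ ∑[ x ∈ xs ] bit (p x)
count-∑ p []       = refl
count-∑ p (x ∷ xs) with p x
... | true  = cong suc (count-∑ p xs)
... | false = count-∑ p xs

∑-filter : ∀ (q : A → Bool) (f : A → ℕ) xs →
           ∑ (filter (λ x → Data.Bool._≟_ (q x) true) xs) f ≡ ∑[ x ∈ xs ] (if q x then f x else 0)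
∑-filter q f []       = refl
∑-filter q f (x ∷ xs) with q x
... | true  = cong (_+_ (f x)) (∑-filter q f xs)
... | false = ∑-filter q f xs

∑-subsets-∷ : ∀ n (f : Subset → ℕ) →
              ∑ (subsets (suc n)) f ≡ ∑[ s ∈ subsets n ] f (true ∷ s) + ∑[ s ∈ subsets n ] f (false ∷ s)
∑-subsets-∷ n f = begin
  ∑ (subsets (suc n)) f                                   ≡⟨ ∑-concatMap _ (subsets n) f ⟩
  ∑[ s ∈ subsets n ] (f (true ∷ s) + (f (false ∷ s) + 0)) ≡⟨ ∑-cong (subsets n) (λ s → cong (_+_ (f (true ∷ s))) (+-identityʳ _)) ⟩
  ∑[ s ∈ subsets n ] (f (true ∷ s) + f (false ∷ s))       ≡⟨ ∑-+ (subsets n) _ _ ⟩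
  ∑[ s ∈ subsets n ] f (true ∷ s) + ∑[ s ∈ subsets n ] f (false ∷ s) ∎

∑-subsets-∷ʳ : ∀ n (f : Subset → ℕ) →
               ∑ (subsets (suc n)) f ≡ ∑[ s ∈ subsets n ] (f (s ∷ʳ true) + f (s ∷ʳ false))
∑-subsets-∷ʳ zero    f = begin
  f (true ∷ []) + (f (false ∷ []) + 0) ≡⟨ cong (_+_ (f (true ∷ []))) (+-identityʳ _) ⟩
  f (true ∷ []) + f (false ∷ [])       ≡⟨ +-identityʳ _ ⟨
  f (true ∷ []) + f (false ∷ []) + 0   ∎
∑-subsets-∷ʳ (suc n) f = begin
  ∑ (subsets (suc (suc n))) f
    ≡⟨ ∑-subsets-∷ (suc n) f ⟩
  ∑[ s ∈ subsets (suc n) ] f (true ∷ s) + ∑[ s ∈ subsets (suc n) ] f (false ∷ s)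
    ≡⟨ cong₂ _+_ (∑-subsets-∷ʳ n _) (∑-subsets-∷ʳ n _) ⟩
  ∑[ s ∈ subsets n ] (f (true ∷ s ∷ʳ true) + f (true ∷ s ∷ʳ false))
    + ∑[ s ∈ subsets n ] (f (false ∷ s ∷ʳ true) + f (false ∷ s ∷ʳ false))
    ≡⟨ ∑-subsets-∷ n (λ s → f (s ∷ʳ true) + f (s ∷ʳ false)) ⟨
  ∑[ s ∈ subsets (suc n) ] (f (s ∷ʳ true) + f (s ∷ʳ false)) ∎

∑-subsets-cong : ∀ n {f g : Subset → ℕ} → (∀ s → length s ≡ n → f s ≡ g s) →
                 ∑ (subsets n) f ≡ ∑ (subsets n) g
∑-subsets-cong zero    f≗g = cong (_+ 0) (f≗g [] refl)
∑-subsets-cong (suc n) {f} {g} f≗g = begin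
  ∑ (subsets (suc n)) f
    ≡⟨ ∑-subsets-∷ n f ⟩
  ∑[ s ∈ subsets n ] f (true ∷ s) + ∑[ s ∈ subsets n ] f (false ∷ s)
    ≡⟨ cong₂ _+_ (∑-subsets-cong n (λ s ∣s∣ → f≗g _ (cong suc ∣s∣)))
                 (∑-subsets-cong n (λ s ∣s∣ → f≗g _ (cong suc ∣s∣))) ⟩
  ∑[ s ∈ subsets n ] g (true ∷ s) + ∑[ s ∈ subsets n ] g (false ∷ s)
    ≡⟨ ∑-subsets-∷ n g ⟨
  ∑ (subsets (suc n)) g ∎

all≤ : (ℕ → Bool) → ℕ → Bool
all≤ p zero    = true
all≤ p (suc n) = all≤ p n ∧ p (suc n)

count≤ : (ℕ → Bool) → ℕ → ℕ
count≤ p zero    = 0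
count≤ p (suc n) = bit (p (suc n)) + count≤ p n

indices-suc : ∀ n → indices (suc n) ≡ indices n ++ [ suc n ]
indices-suc n = trans (cong (map suc) (sym (upTo-∷ʳ n))) (map-++ suc (upTo n) [ n ])

allB-++ : ∀ (p : A → Bool) xs ys → allB p (xs ++ ys) ≡ allB p xs ∧ allB p ys
allB-++ p []       ys = refl
allB-++ p (x ∷ xs) ys = trans (cong (p x ∧_) (allB-++ p xs ys)) (sym (∧-assoc (p x) _ _))

allB-indices : ∀ (p : ℕ → Bool) n → allB p (indices n) ≡ all≤ p n
allB-indices p zero    = refl
allB-indices p (suc n) = begin
  allB p (indices (suc n))                ≡⟨ cong (allB p) (indices-suc n) ⟩
  allB p (indices n ++ [ suc n ])         ≡⟨ allB-++ p (indices n) [ suc n ] ⟩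
  allB p (indices n) ∧ (p (suc n) ∧ true) ≡⟨ cong₂ _∧_ (allB-indices p n) (∧-identityʳ _) ⟩
  all≤ p n ∧ p (suc n)                    ∎

count-indices : ∀ (p : ℕ → Bool) n → count p (indices n) ≡ count≤ p n
count-indices p n = trans (count-∑ p (indices n)) (∑-indices n)
  where
  ∑-indices : ∀ n → ∑[ i ∈ indices n ] bit (p i) ≡ count≤ p n
  ∑-indices zero    = refl
  ∑-indices (suc n) = begin
    ∑[ i ∈ indices (suc n) ] bit (p i)                 ≡⟨ cong (λ is → ∑[ i ∈ is ] bit (p i)) (indices-suc n) ⟩
    ∑[ i ∈ indices n ++ [ suc n ] ] bit (p i)          ≡⟨ ∑-++ (indices n) _ _ ⟩
    ∑[ i ∈ indices n ] bit (p i) + (bit (p (suc n)) + 0) ≡⟨ cong₂ _+_ (∑-indices n) (+-identityʳ _) ⟩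
    count≤ p n + bit (p (suc n))                       ≡⟨ +-comm (count≤ p n) _ ⟩
    count≤ p (suc n)                                   ∎

all≤-cong : ∀ n {p q : ℕ → Bool} → (∀ a → 1 ≤ a → a ≤ n → p a ≡ q a) → all≤ p n ≡ all≤ q n
all≤-cong zero    p≗q = refl
all≤-cong (suc n) p≗q =
  cong₂ _∧_ (all≤-cong n (λ a 1≤a a≤n → p≗q a 1≤a (m≤n⇒m≤1+n a≤n))) (p≗q (suc n) (s≤s z≤n) ≤-refl)

count≤-cong : ∀ n {p q : ℕ → Bool} → (∀ a → 1 ≤ a → a ≤ n → p a ≡ q a) → count≤ p n ≡ count≤ q n
count≤-cong zero    p≗q = refl
count≤-cong (suc n) p≗q =
  cong₂ _+_ (cong bit (p≗q (suc n) (s≤s z≤n) ≤-refl)) (count≤-cong n (λ a 1≤a a≤n → p≗q a 1≤a (m≤n⇒m≤1+n a≤n)))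

all≤-true : ∀ n {p : ℕ → Bool} → (∀ a → a ≤ n → p a ≡ true) → all≤ p n ≡ true
all≤-true zero    p≡true = refl
all≤-true (suc n) p≡true =
  cong₂ _∧_ (all≤-true n (λ a a≤n → p≡true a (m≤n⇒m≤1+n a≤n))) (p≡true (suc n) ≤-refl)

all≤-∧ : ∀ n (p q : ℕ → Bool) → all≤ (λ a → p a ∧ q a) n ≡ all≤ p n ∧ all≤ q n
all≤-∧ zero    p q = refl
all≤-∧ (suc n) p q = trans (cong (_∧ (p (suc n) ∧ q (suc n))) (all≤-∧ n p q))
                           (∧-interchange (all≤ p n) (all≤ q n) (p (suc n)) (q (suc n)))

all≤-grid-suc : ∀ n (R : ℕ → ℕ → Bool) →
  all≤ (λ a → all≤ (R a) (suc n)) (suc n) ≡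
  (all≤ (λ a → all≤ (R a) n) n ∧ all≤ (λ a → R a (suc n)) n) ∧ all≤ (R (suc n)) (suc n)
all≤-grid-suc n R = cong (_∧ all≤ (R (suc n)) (suc n)) (all≤-∧ n (λ a → all≤ (R a) n) (λ a → R a (suc n)))

count≤-∧ʳ : ∀ (p : ℕ → Bool) q n → count≤ (λ i → p i ∧ q) n ≡ (if q then count≤ p n else 0)
count≤-∧ʳ p true  n = count≤-cong n (λ i _ _ → ∧-identityʳ (p i))
count≤-∧ʳ p false zero    = refl
count≤-∧ʳ p false (suc n) = cong₂ _+_ (cong bit (∧-zeroʳ (p (suc n)))) (count≤-∧ʳ p false n)

mem-∷ʳ : ∀ s b i → i ≤ length s → mem (s ∷ʳ b) i ≡ mem s i
mem-∷ʳ []      b zero          z≤n     = refl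
mem-∷ʳ (x ∷ s) b zero          _       = refl
mem-∷ʳ (x ∷ s) b (suc zero)    _       = refl
mem-∷ʳ (x ∷ s) b (suc (suc i)) (s≤s i≤∣s∣) = mem-∷ʳ s b (suc i) i≤∣s∣

mem-∷ʳ-last : ∀ s b → mem (s ∷ʳ b) (suc (length s)) ≡ b
mem-∷ʳ-last []      b = refl
mem-∷ʳ-last (x ∷ s) b = mem-∷ʳ-last s b

toggle-∷ʳ : ∀ s b i → i ≤ length s → toggle (s ∷ʳ b) i ≡ toggle s i ∷ʳ b
toggle-∷ʳ []      b zero          z≤n     = refl
toggle-∷ʳ (x ∷ s) b zero          _       = refl
toggle-∷ʳ (x ∷ s) b (suc zero)    _       = refl
toggle-∷ʳ (x ∷ s) b (suc (suc i)) (s≤s i≤∣s∣) = cong (x ∷_) (toggle-∷ʳ s b (suc i) i≤∣s∣)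

toggle-∷ʳ-last : ∀ s b → toggle (s ∷ʳ b) (suc (length s)) ≡ s ∷ʳ not b
toggle-∷ʳ-last []      b = refl
toggle-∷ʳ-last (x ∷ s) b = cong (x ∷_) (toggle-∷ʳ-last s b)

length-toggle : ∀ s i → length (toggle s i) ≡ length s
length-toggle []      i             = refl
length-toggle (x ∷ s) zero          = refl
length-toggle (x ∷ s) (suc zero)    = refl
length-toggle (x ∷ s) (suc (suc i)) = cong suc (length-toggle s (suc i))

mem-toggle-≢ : ∀ s i j → i ≢ j → mem (toggle s i) j ≡ mem s j
mem-toggle-≢ []      i             j             i≢j = refl
mem-toggle-≢ (x ∷ s) zero          j             i≢j = refl
mem-toggle-≢ (x ∷ s) (suc zero)    zero          i≢j = refl
mem-toggle-≢ (x ∷ s) (suc zero)    (suc zero)    i≢j = ⊥-elim (i≢j refl)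
mem-toggle-≢ (x ∷ s) (suc zero)    (suc (suc j)) i≢j = refl
mem-toggle-≢ (x ∷ s) (suc (suc i)) zero          i≢j = refl
mem-toggle-≢ (x ∷ s) (suc (suc i)) (suc zero)    i≢j = refl
mem-toggle-≢ (x ∷ s) (suc (suc i)) (suc (suc j)) i≢j = mem-toggle-≢ s (suc i) (suc j) (λ i≡j → i≢j (cong suc i≡j))

mem-toggle-self : ∀ s i → 1 ≤ i → i ≤ length s → mem (toggle s i) i ≡ not (mem s i)
mem-toggle-self (x ∷ s) (suc zero)    _ _           = refl
mem-toggle-self (x ∷ s) (suc (suc i)) _ (s≤s i≤∣s∣) = mem-toggle-self s (suc i) (s≤s z≤n) i≤∣s∣

compatible : Subset → ℕ → ℕ → Bool
compatible U a b = not (cover a b ∧ mem U a ∧ not (mem U b))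

compatible-refl : ∀ U a → compatible U a a ≡ true
compatible-refl U a with mem U a
... | true  = cong not (∧-zeroʳ (cover a a))
... | false = cong not (∧-zeroʳ (cover a a))

isFilter-all≤ : ∀ n U → isFilter n U ≡ all≤ (λ a → all≤ (compatible U a) n) n
isFilter-all≤ n U = trans (allB-indices _ n) (all≤-cong n (λ a _ _ → allB-indices _ n))

degree-count≤ : ∀ n U → degree n U ≡ count≤ (λ i → isFilter n (toggle U i)) n
degree-count≤ n U = count-indices _ n

-- The covers of a top element x_{6+r}

≢⇒≡ᵇ-false : ∀ m n → m ≢ n → (m ≡ᵇ n) ≡ false
≢⇒≡ᵇ-false m n m≢n with m ≡ᵇ n | ≡ᵇ⇒≡ m n
... | true  | m≡n = ⊥-elim (m≢n (m≡n tt))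
... | false | _   = refl

≡ᵇ-refl : ∀ n → (n ≡ᵇ n) ≡ true
≡ᵇ-refl zero    = refl
≡ᵇ-refl (suc n) = ≡ᵇ-refl n

isEven-suc : ∀ n → isEven (suc n) ≡ not (isEven n)
isEven-suc zero          = refl
isEven-suc (suc zero)    = refl
isEven-suc (suc (suc n)) = isEven-suc n

adjacent : ℕ → ℕ → Bool
adjacent a b = ((a + 1) ≡ᵇ b) ∨ (a ≡ᵇ (b + 1))

adjacent-suc : ∀ n → adjacent n (suc n) ≡ true
adjacent-suc n rewrite +-comm n 1 | ≡ᵇ-refl n = refl

adjacent-pred : ∀ n → adjacent (suc n) n ≡ true
adjacent-pred n rewrite +-comm n 1 | ≡ᵇ-refl n = ∨-zeroʳ _

adjacent-far : ∀ r a → a ≤ 4 + r → adjacent a (6 + r) ≡ false × adjacent (6 + r) a ≡ false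
adjacent-far r a a≤4+r =
  cong₂ _∨_ (≢⇒≡ᵇ-false _ _ (<⇒≢ a+1<6+r)) (≢⇒≡ᵇ-false _ _ (<⇒≢ a<6+r+1)) ,
  cong₂ _∨_ (≢⇒≡ᵇ-false _ _ (>⇒≢ a<6+r+1)) (≢⇒≡ᵇ-false _ _ (>⇒≢ a+1<6+r))
  where
  a+1<6+r : a + 1 < 6 + r
  a+1<6+r = subst (_< 6 + r) (+-comm 1 a) (s≤s (s≤s a≤4+r))
  a<6+r+1 : a < 6 + r + 1
  a<6+r+1 = ≤-trans (s≤s a≤4+r) (m≤n⇒m≤1+n (m≤m+n (5 + r) 1))

cover-into-≥6 : ∀ a r → cover a (6 + r) ≡ isEven r ∧ adjacent a (6 + r)
cover-into-≥6 0 r = refl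
cover-into-≥6 1 r = refl
cover-into-≥6 2 r = refl
cover-into-≥6 3 r = refl
cover-into-≥6 4 r = refl
cover-into-≥6 5 r = refl
cover-into-≥6 (suc (suc (suc (suc (suc (suc a)))))) r = refl

cover-below-top : ∀ r a → a ≤ 4 + r → cover a (6 + r) ≡ false
cover-below-top r a a≤4+r =
  trans (cover-into-≥6 a r) (trans (cong (isEven r ∧_) (proj₁ (adjacent-far r a a≤4+r))) (∧-zeroʳ _))

cover-above-top : ∀ r a → a ≤ 4 + r → cover (6 + r) a ≡ false
cover-above-top r a a≤4+r =
  trans (cong (λ x → isEven a ∧ atLeast6 a ∧ x) (proj₂ (adjacent-far r a a≤4+r)))
        (trans (cong (isEven a ∧_) (∧-zeroʳ _)) (∧-zeroʳ _))

cover-top-up : ∀ r → cover (5 + r) (6 + r) ≡ isEven r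
cover-top-up r = trans (cover-into-≥6 (5 + r) r) (trans (cong (isEven r ∧_) (adjacent-suc (5 + r))) (∧-identityʳ _))

cover-top-down : ∀ r → cover (6 + r) (5 + r) ≡ not (isEven r)
cover-top-down zero    = refl
cover-top-down (suc r) = begin
  isEven r ∧ adjacent (7 + r) (6 + r) ≡⟨ cong (isEven r ∧_) (adjacent-pred (6 + r)) ⟩
  isEven r ∧ true                     ≡⟨ ∧-identityʳ _ ⟩
  isEven r                            ≡⟨ not-involutive _ ⟨
  not (not (isEven r))                ≡⟨ cong not (isEven-suc r) ⟨
  not (isEven (suc r))                ∎

-- Extending a filter by a new top element

-- For n ≥ 5, x_n pins x_{n+1} in s: for odd n (where x_n < x_{n+1}) when x_n ∈ s,
-- for even n (where x_{n+1} < x_n) when x_n ∉ s.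
pinned : ℕ → Subset → Bool
pinned n s = isEven n xor mem s n

pinned-∷ʳ : ∀ r s b → length s ≡ 5 + r → pinned (6 + r) (s ∷ʳ b) ≡ isEven r xor b
pinned-∷ʳ r s b ∣s∣ = cong (isEven r xor_) (subst (λ m → mem (s ∷ʳ b) (suc m) ≡ b) ∣s∣ (mem-∷ʳ-last s b))

pinned-compatible : ∀ e u b →
  not (e ∧ u ∧ not b) ∧ not (not e ∧ b ∧ not u) ≡ not ((not e xor u) ∧ (e xor b))
pinned-compatible true  true  true  = refl
pinned-compatible true  true  false = refl
pinned-compatible true  false b     = refl
pinned-compatible false true  true  = refl
pinned-compatible false true  false = refl
pinned-compatible false false true  = refl
pinned-compatible false false false = refl

isFilter-∷ʳ : ∀ r s b → length s ≡ 5 + r →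
  isFilter (6 + r) (s ∷ʳ b) ≡ isFilter (5 + r) s ∧ not (pinned (5 + r) s ∧ (isEven r xor b))
isFilter-∷ʳ r s b ∣s∣ = begin
  isFilter (6 + r) V
    ≡⟨ isFilter-all≤ (6 + r) V ⟩
  all≤ (λ a → all≤ (compatible V a) (6 + r)) (6 + r)
    ≡⟨ all≤-grid-suc (5 + r) (compatible V) ⟩
  (all≤ (λ a → all≤ (compatible V a) (5 + r)) (5 + r) ∧ all≤ (λ a → compatible V a (6 + r)) (5 + r))
    ∧ all≤ (compatible V (6 + r)) (6 + r)
    ≡⟨ cong₂ _∧_ (cong₂ _∧_ old-rows new-column) new-row ⟩
  (isFilter (5 + r) s ∧ not (e ∧ u ∧ not b)) ∧ (not (not e ∧ b ∧ not u) ∧ true)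
    ≡⟨ cong ((isFilter (5 + r) s ∧ not (e ∧ u ∧ not b)) ∧_) (∧-identityʳ _) ⟩
  (isFilter (5 + r) s ∧ not (e ∧ u ∧ not b)) ∧ not (not e ∧ b ∧ not u)
    ≡⟨ ∧-assoc (isFilter (5 + r) s) _ _ ⟩
  isFilter (5 + r) s ∧ (not (e ∧ u ∧ not b) ∧ not (not e ∧ b ∧ not u))
    ≡⟨ cong (isFilter (5 + r) s ∧_) (pinned-compatible e u b) ⟩
  isFilter (5 + r) s ∧ not ((not e xor u) ∧ (e xor b))
    ≡⟨ cong (λ x → isFilter (5 + r) s ∧ not ((x xor u) ∧ (e xor b))) (isEven-suc r) ⟨
  isFilter (5 + r) s ∧ not (pinned (5 + r) s ∧ (e xor b)) ∎
  where
  cong₃ : ∀ {x x' y y' z z' : Bool} (f : Bool → Bool → Bool → Bool) → x ≡ x' → y ≡ y' → z ≡ z' → f x y z ≡ f x' y' z'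
  cong₃ f refl refl refl = refl
  V = s ∷ʳ b
  e = isEven r
  u = mem s (5 + r)
  mem-V : ∀ a → a ≤ 5 + r → mem V a ≡ mem s a
  mem-V a a≤5+r = mem-∷ʳ s b a (subst (a ≤_) (sym ∣s∣) a≤5+r)
  mem-V-top : mem V (6 + r) ≡ b
  mem-V-top = subst (λ m → mem V (suc m) ≡ b) ∣s∣ (mem-∷ʳ-last s b)
  old-rows : all≤ (λ a → all≤ (compatible V a) (5 + r)) (5 + r) ≡ isFilter (5 + r) s
  old-rows = trans (all≤-cong (5 + r) (λ a _ a≤ → all≤-cong (5 + r) (λ c _ c≤ →
                      cong₂ (λ x y → not (cover a c ∧ x ∧ not y)) (mem-V a a≤) (mem-V c c≤))))
                   (sym (isFilter-all≤ (5 + r) s))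
  new-column : all≤ (λ a → compatible V a (6 + r)) (5 + r) ≡ not (e ∧ u ∧ not b)
  new-column = cong₂ _∧_
    (all≤-true (4 + r) (λ a a≤ → cong (λ x → not (x ∧ mem V a ∧ not (mem V (6 + r)))) (cover-below-top r a a≤)))
    (cong₃ (λ x y z → not (x ∧ y ∧ not z)) (cover-top-up r) (mem-V (5 + r) ≤-refl) mem-V-top)
  new-row : all≤ (compatible V (6 + r)) (6 + r) ≡ not (not e ∧ b ∧ not u) ∧ true
  new-row = cong₂ _∧_
    (cong₂ _∧_
      (all≤-true (4 + r) (λ a a≤ → cong (λ x → not (x ∧ mem V (6 + r) ∧ not (mem V a))) (cover-above-top r a a≤)))
      (cong₃ (λ x y z → not (x ∧ y ∧ not z)) (cover-top-down r) mem-V-top (mem-V (5 + r) ≤-refl)))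
    (compatible-refl V (6 + r))

pinned-toggle-≢ : ∀ n s i → i ≢ n → pinned n (toggle s i) ≡ pinned n s
pinned-toggle-≢ n s i i≢n = cong (isEven n xor_) (mem-toggle-≢ s i n i≢n)

pinned-toggle-self : ∀ n s → 1 ≤ n → n ≤ length s → pinned n (toggle s n) ≡ not (pinned n s)
pinned-toggle-self n s 1≤n n≤∣s∣ =
  trans (cong (isEven n xor_) (mem-toggle-self s n 1≤n n≤∣s∣)) (sym (not-distribʳ-xor (isEven n) (mem s n)))

isFilter-toggle-∷ʳ : ∀ r s b i → length s ≡ 5 + r → i ≤ 5 + r →
  isFilter (6 + r) (toggle (s ∷ʳ b) i) ≡ isFilter (5 + r) (toggle s i) ∧ not (pinned (5 + r) (toggle s i) ∧ (isEven r xor b))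
isFilter-toggle-∷ʳ r s b i ∣s∣ i≤5+r =
  trans (cong (isFilter (6 + r)) (toggle-∷ʳ s b i (subst (i ≤_) (sym ∣s∣) i≤5+r)))
        (isFilter-∷ʳ r (toggle s i) b (trans (length-toggle s i) ∣s∣))

isFilter-toggle-top : ∀ r s b → length s ≡ 5 + r →
  isFilter (6 + r) (toggle (s ∷ʳ b) (6 + r)) ≡ isFilter (5 + r) s ∧ not (pinned (5 + r) s ∧ not (isEven r xor b))
isFilter-toggle-top r s b ∣s∣ = begin
  isFilter (6 + r) (toggle (s ∷ʳ b) (6 + r))
    ≡⟨ cong (isFilter (6 + r)) (subst (λ m → toggle (s ∷ʳ b) (suc m) ≡ s ∷ʳ not b) ∣s∣ (toggle-∷ʳ-last s b)) ⟩
  isFilter (6 + r) (s ∷ʳ not b)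
    ≡⟨ isFilter-∷ʳ r s (not b) ∣s∣ ⟩
  isFilter (5 + r) s ∧ not (pinned (5 + r) s ∧ (isEven r xor not b))
    ≡⟨ cong (λ x → isFilter (5 + r) s ∧ not (pinned (5 + r) s ∧ x)) (not-distribʳ-xor (isEven r) b) ⟨
  isFilter (5 + r) s ∧ not (pinned (5 + r) s ∧ not (isEven r xor b)) ∎

lowerDegree-∷ʳ : ∀ r s b → length s ≡ 5 + r →
  let P = pinned (5 + r) s
      β = isEven r xor b in
  count≤ (λ i → isFilter (6 + r) (toggle (s ∷ʳ b) i)) (5 + r) ≡
    bit (isFilter (5 + r) (toggle s (5 + r)) ∧ not (not P ∧ β))
    + (if not (P ∧ β) then count≤ (λ i → isFilter (5 + r) (toggle s i)) (4 + r) else 0)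
lowerDegree-∷ʳ r s b ∣s∣ = cong₂ _+_ (cong bit top) lower
  where
  P = pinned (5 + r) s
  β = isEven r xor b
  top : isFilter (6 + r) (toggle (s ∷ʳ b) (5 + r)) ≡ isFilter (5 + r) (toggle s (5 + r)) ∧ not (not P ∧ β)
  top = trans (isFilter-toggle-∷ʳ r s b (5 + r) ∣s∣ ≤-refl)
              (cong (λ x → isFilter (5 + r) (toggle s (5 + r)) ∧ not (x ∧ β))
                    (pinned-toggle-self (5 + r) s (s≤s z≤n) (subst (5 + r ≤_) (sym ∣s∣) ≤-refl)))
  lower : count≤ (λ i → isFilter (6 + r) (toggle (s ∷ʳ b) i)) (4 + r) ≡
          (if not (P ∧ β) then count≤ (λ i → isFilter (5 + r) (toggle s i)) (4 + r) else 0)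
  lower = trans (count≤-cong (4 + r) (λ i _ i≤4+r →
                   trans (isFilter-toggle-∷ʳ r s b i ∣s∣ (m≤n⇒m≤1+n i≤4+r))
                         (cong (λ x → isFilter (5 + r) (toggle s i) ∧ not (x ∧ β))
                               (pinned-toggle-≢ (5 + r) s i (<⇒≢ (s≤s i≤4+r))))))
                (count≤-∧ʳ (λ i → isFilter (5 + r) (toggle s i)) (not (P ∧ β)) (4 + r))

record Signature : Set where
  constructor ⟨_,_,_,_⟩
  field
    isFilt      : Bool
    topPinned   : Bool
    topToggles  : Bool
    lowerDegree : ℕ

signature : ℕ → Subset → Signature
signature n s =
  ⟨ isFilter n s , pinned n s , isFilter n (toggle s n) , count≤ (λ i → isFilter n (toggle s i)) (n ∸ 1) ⟩

extend : Signature → Bool → Signature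
extend ⟨ F , P , T , c ⟩ β =
  ⟨ F ∧ not (P ∧ β) , β , F ∧ not (P ∧ not β) , bit (T ∧ not (not P ∧ β)) + (if not (P ∧ β) then c else 0) ⟩

signature-∷ʳ : ∀ r s b → length s ≡ 5 + r →
  signature (6 + r) (s ∷ʳ b) ≡ extend (signature (5 + r) s) (isEven r xor b)
signature-∷ʳ r s b ∣s∣ =
  fields-≡ (isFilter-∷ʳ r s b ∣s∣) (pinned-∷ʳ r s b ∣s∣) (isFilter-toggle-top r s b ∣s∣) (lowerDegree-∷ʳ r s b ∣s∣)
  where
  fields-≡ : ∀ {F F' P P' T T' c c'} → F ≡ F' → P ≡ P' → T ≡ T' → c ≡ c' → ⟨ F , P , T , c ⟩ ≡ ⟨ F' , P' , T' , c' ⟩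
  fields-≡ refl refl refl refl = refl

-- The transfer matrix

_==_ : Bool → Bool → Bool
a == b = not (a xor b)

Vector : Set
Vector = Bool → Bool → ℕ → ℕ

_≋_ : Vector → Vector → Set
g ≋ h = ∀ p t k → g p t k ≡ h p t k

weight : Signature → Vector
weight ⟨ F , P , T , c ⟩ p t k = bit (F ∧ (P == p) ∧ (T == t) ∧ (bit T + c ≡ᵇ k))

-- A state (p, t) records whether the top is pinned and whether it can be toggled.  A filter in state
-- (false, T) of degree bit T + c extends unpinned into state (false, true) with degree bit T + c + 1
-- and pinned into state (true, true) with degree c + 1; a filter in state (true, T) only extends
-- unpinned, into state (false, false) with the same degree.
transfer : Vector → Vector
transfer g false false k       = g true false k + g true true k
transfer g false true  zero    = 0
transfer g false true  (suc k) = g false false k + g false true k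
transfer g true  false k       = 0
transfer g true  true  zero    = g false true zero
transfer g true  true  (suc k) = g false false k + g false true (suc k)

transfer-cong : ∀ {g h} → g ≋ h → transfer g ≋ transfer h
transfer-cong g≋h false false k       = cong₂ _+_ (g≋h true false k) (g≋h true true k)
transfer-cong g≋h false true  zero    = refl
transfer-cong g≋h false true  (suc k) = cong₂ _+_ (g≋h false false k) (g≋h false true k)
transfer-cong g≋h true  false k       = refl
transfer-cong g≋h true  true  zero    = g≋h false true zero
transfer-cong g≋h true  true  (suc k) = cong₂ _+_ (g≋h false false k) (g≋h false true (suc k))

weight-extend : ∀ σ p t k →
  weight (extend σ true) p t k + weight (extend σ false) p t k ≡ transfer (weight σ) p t k
weight-extend ⟨ false , P     , T     , c ⟩ false false k       = refl
weight-extend ⟨ false , P     , T     , c ⟩ false true  zero    = refl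
weight-extend ⟨ false , P     , T     , c ⟩ false true  (suc k) = refl
weight-extend ⟨ false , P     , T     , c ⟩ true  false k       = refl
weight-extend ⟨ false , P     , T     , c ⟩ true  true  zero    = refl
weight-extend ⟨ false , P     , T     , c ⟩ true  true  (suc k) = refl
weight-extend ⟨ true  , false , T     , c ⟩ false false k       = refl
weight-extend ⟨ true  , false , T     , c ⟩ false true  zero    = refl
weight-extend ⟨ true  , false , false , c ⟩ false true  (suc k) = sym (+-identityʳ _)
weight-extend ⟨ true  , false , true  , c ⟩ false true  (suc k) = refl
weight-extend ⟨ true  , false , T     , c ⟩ true  false k       = refl
weight-extend ⟨ true  , false , false , c ⟩ true  true  zero    = refl
weight-extend ⟨ true  , false , true  , c ⟩ true  true  zero    = refl
weight-extend ⟨ true  , false , false , c ⟩ true  true  (suc k) = refl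
weight-extend ⟨ true  , false , true  , c ⟩ true  true  (suc k) = +-identityʳ _
weight-extend ⟨ true  , true  , false , c ⟩ false false k       = sym (+-identityʳ _)
weight-extend ⟨ true  , true  , true  , c ⟩ false false k       = refl
weight-extend ⟨ true  , true  , T     , c ⟩ false true  zero    = refl
weight-extend ⟨ true  , true  , T     , c ⟩ false true  (suc k) = refl
weight-extend ⟨ true  , true  , T     , c ⟩ true  false k       = refl
weight-extend ⟨ true  , true  , T     , c ⟩ true  true  zero    = refl
weight-extend ⟨ true  , true  , T     , c ⟩ true  true  (suc k) = refl

total : Vector → ℕ → ℕ
total g k = g false false k + (g false true k + (g true false k + g true true k))

total-cong : ∀ {g h} → g ≋ h → ∀ k → total g k ≡ total h k
total-cong g≋h k =
  cong₂ _+_ (g≋h false false k) (cong₂ _+_ (g≋h false true k) (cong₂ _+_ (g≋h true false k) (g≋h true true k)))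

weight-total : ∀ σ k →
  (if Signature.isFilt σ then bit (bit (Signature.topToggles σ) + Signature.lowerDegree σ ≡ᵇ k) else 0)
  ≡ total (weight σ) k
weight-total ⟨ false , P     , T     , c ⟩ k = refl
weight-total ⟨ true  , false , false , c ⟩ k = sym (+-identityʳ _)
weight-total ⟨ true  , false , true  , c ⟩ k = sym (+-identityʳ _)
weight-total ⟨ true  , true  , false , c ⟩ k = sym (+-identityʳ _)
weight-total ⟨ true  , true  , true  , c ⟩ k = refl

stateCount : ℕ → Vector
stateCount n p t k = ∑[ s ∈ subsets n ] weight (signature n s) p t k

∑-total : ∀ (xs : List A) (v : A → Vector) k →
  ∑[ x ∈ xs ] total (v x) k ≡ total (λ p t k → ∑[ x ∈ xs ] v x p t k) k
∑-total {A = A} xs v k =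
  trans (∑-+ xs (v′ false false) _) (cong (_+_ (∑ xs (v′ false false)))
  (trans (∑-+ xs (v′ false true) _) (cong (_+_ (∑ xs (v′ false true)))
  (∑-+ xs (v′ true false) (v′ true true)))))
  where
  v′ : Bool → Bool → A → ℕ
  v′ p t x = v x p t k

transfer-∑ : ∀ (xs : List A) (v : A → Vector) p t k →
  ∑[ x ∈ xs ] transfer (v x) p t k ≡ transfer (λ p t k → ∑[ x ∈ xs ] v x p t k) p t k
transfer-∑ xs v false false k       = ∑-+ xs _ _
transfer-∑ xs v false true  zero    = ∑-zero xs
transfer-∑ xs v false true  (suc k) = ∑-+ xs _ _
transfer-∑ xs v true  false k       = ∑-zero xs
transfer-∑ xs v true  true  zero    = refl
transfer-∑ xs v true  true  (suc k) = ∑-+ xs _ _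

d-total : ∀ m k → d (suc m) k ≡ total (stateCount (suc m)) k
d-total m k = begin
  d (suc m) k
    ≡⟨ count-∑ _ (filters (suc m)) ⟩
  ∑[ U ∈ filters (suc m) ] bit (degree (suc m) U ≡ᵇ k)
    ≡⟨ ∑-filter (isFilter (suc m)) _ (subsets (suc m)) ⟩
  ∑[ U ∈ subsets (suc m) ] (if isFilter (suc m) U then bit (degree (suc m) U ≡ᵇ k) else 0)
    ≡⟨ ∑-cong (subsets (suc m)) (λ U → trans (cong (λ δ → if isFilter (suc m) U then bit (δ ≡ᵇ k) else 0)
                                                    (degree-count≤ (suc m) U))
                                             (weight-total (signature (suc m) U) k)) ⟩
  ∑[ U ∈ subsets (suc m) ] total (weight (signature (suc m) U)) k
    ≡⟨ ∑-total (subsets (suc m)) (λ U → weight (signature (suc m) U)) k ⟩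
  total (stateCount (suc m)) k ∎

xor-sum : ∀ c (f : Bool → ℕ) → f (c xor true) + f (c xor false) ≡ f true + f false
xor-sum false f = refl
xor-sum true  f = +-comm (f false) (f true)

stateCount-step : ∀ r p t k → stateCount (6 + r) p t k ≡ transfer (stateCount (5 + r)) p t k
stateCount-step r p t k = begin
  stateCount (6 + r) p t k
    ≡⟨ ∑-subsets-∷ʳ (5 + r) _ ⟩
  ∑[ s ∈ subsets (5 + r) ] (weight (signature (6 + r) (s ∷ʳ true)) p t k + weight (signature (6 + r) (s ∷ʳ false)) p t k)
    ≡⟨ ∑-subsets-cong (5 + r) extensions ⟩
  ∑[ s ∈ subsets (5 + r) ] transfer (weight (signature (5 + r) s)) p t k
    ≡⟨ transfer-∑ (subsets (5 + r)) _ p t k ⟩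
  transfer (stateCount (5 + r)) p t k ∎
  where
  extensions : ∀ s → length s ≡ 5 + r →
    weight (signature (6 + r) (s ∷ʳ true)) p t k + weight (signature (6 + r) (s ∷ʳ false)) p t k
    ≡ transfer (weight (signature (5 + r) s)) p t k
  extensions s ∣s∣ = begin
    weight (signature (6 + r) (s ∷ʳ true)) p t k + weight (signature (6 + r) (s ∷ʳ false)) p t k
      ≡⟨ cong₂ _+_ (cong (λ σ → weight σ p t k) (signature-∷ʳ r s true ∣s∣))
                   (cong (λ σ → weight σ p t k) (signature-∷ʳ r s false ∣s∣)) ⟩
    weight (extend σ (isEven r xor true)) p t k + weight (extend σ (isEven r xor false)) p t k
      ≡⟨ xor-sum (isEven r) (λ β → weight (extend σ β) p t k) ⟩
    weight (extend σ true) p t k + weight (extend σ false) p t k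
      ≡⟨ weight-extend σ p t k ⟩
    transfer (weight σ) p t k ∎
    where σ = signature (5 + r) s

shift : (ℕ → ℕ) → ℕ → ℕ
shift f zero    = 0
shift f (suc k) = f k

shift-cong : ∀ {f g : ℕ → ℕ} → (∀ k → f k ≡ g k) → ∀ k → shift f k ≡ shift g k
shift-cong f≗g zero    = refl
shift-cong f≗g (suc k) = f≗g k

-- Cayley–Hamilton for transfer, read off coefficientwise: once k is split into its first values
-- every shift reduces, and abstracting the values of g leaves a polynomial identity.
total-transfer-recurrence : ∀ g k →
  total (transfer (transfer (transfer g))) k + shift (shift (total g)) k
  ≡ shift (total (transfer (transfer g))) k + (shift (total (transfer g)) k + shift (total g) k)
total-transfer-recurrence g zero
  with g false false 0 | g false true 0 | g true false 0 | g true true 0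
... | a₀ | b₀ | c₀ | d₀ = solve (a₀ ∷ b₀ ∷ c₀ ∷ d₀ ∷ [])
total-transfer-recurrence g (suc zero)
  with g false false 0 | g false true 0 | g true false 0 | g true true 0
     | g false false 1 | g false true 1 | g true false 1 | g true true 1
... | a₀ | b₀ | c₀ | d₀ | a₁ | b₁ | c₁ | d₁ =
  solve (a₀ ∷ b₀ ∷ c₀ ∷ d₀ ∷ a₁ ∷ b₁ ∷ c₁ ∷ d₁ ∷ [])
total-transfer-recurrence g (suc (suc zero))
  with g false false 0 | g false true 0 | g true false 0 | g true true 0
     | g false false 1 | g false true 1 | g true false 1 | g true true 1
     | g false false 2 | g false true 2 | g true false 2 | g true true 2
... | a₀ | b₀ | c₀ | d₀ | a₁ | b₁ | c₁ | d₁ | a₂ | b₂ | c₂ | d₂ =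
  solve (a₀ ∷ b₀ ∷ c₀ ∷ d₀ ∷ a₁ ∷ b₁ ∷ c₁ ∷ d₁ ∷ a₂ ∷ b₂ ∷ c₂ ∷ d₂ ∷ [])
total-transfer-recurrence g (suc (suc (suc j)))
  with g false false j       | g false true j       | g true false j       | g true true j
     | g false false (1 + j) | g false true (1 + j) | g true false (1 + j) | g true true (1 + j)
     | g false false (2 + j) | g false true (2 + j) | g true false (2 + j) | g true true (2 + j)
     | g false false (3 + j) | g false true (3 + j) | g true false (3 + j) | g true true (3 + j)
... | a₀ | b₀ | c₀ | d₀ | a₁ | b₁ | c₁ | d₁ | a₂ | b₂ | c₂ | d₂ | a₃ | b₃ | c₃ | d₃ =
  solve (a₀ ∷ b₀ ∷ c₀ ∷ d₀ ∷ a₁ ∷ b₁ ∷ c₁ ∷ d₁ ∷ a₂ ∷ b₂ ∷ c₂ ∷ d₂ ∷ a₃ ∷ b₃ ∷ c₃ ∷ d₃ ∷ [])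

d-recurrenceℕ : ∀ q k →
  d (8 + q) k + shift (shift (d (5 + q))) k ≡ shift (d (7 + q)) k + (shift (d (6 + q)) k + shift (d (5 + q)) k)
d-recurrenceℕ q k = begin
  d (8 + q) k + shift (shift (d (5 + q))) k
    ≡⟨ cong₂ _+_ (d₃ k) (shift-cong (shift-cong d₀) k) ⟩
  total (transfer (transfer (transfer g))) k + shift (shift (total g)) k
    ≡⟨ total-transfer-recurrence g k ⟩
  shift (total (transfer (transfer g))) k + (shift (total (transfer g)) k + shift (total g) k)
    ≡⟨ cong₂ _+_ (shift-cong d₂ k) (cong₂ _+_ (shift-cong d₁ k) (shift-cong d₀ k)) ⟨
  shift (d (7 + q)) k + (shift (d (6 + q)) k + shift (d (5 + q)) k) ∎
  where
  g = stateCount (5 + q)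
  level₁ : stateCount (6 + q) ≋ transfer g
  level₁ = stateCount-step q
  level₂ : stateCount (7 + q) ≋ transfer (transfer g)
  level₂ p t k = trans (stateCount-step (1 + q) p t k) (transfer-cong level₁ p t k)
  level₃ : stateCount (8 + q) ≋ transfer (transfer (transfer g))
  level₃ p t k = trans (stateCount-step (2 + q) p t k) (transfer-cong level₂ p t k)
  d₀ : ∀ k → d (5 + q) k ≡ total g k
  d₀ = d-total (4 + q)
  d₁ : ∀ k → d (6 + q) k ≡ total (transfer g) k
  d₁ k = trans (d-total (5 + q) k) (total-cong level₁ k)
  d₂ : ∀ k → d (7 + q) k ≡ total (transfer (transfer g)) k
  d₂ k = trans (d-total (6 + q) k) (total-cong level₂ k)
  d₃ : ∀ k → d (8 + q) k ≡ total (transfer (transfer (transfer g))) k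
  d₃ k = trans (d-total (7 + q) k) (total-cong level₃ k)

x·-D : ∀ m k → x· (D m) k ≡ + shift (d m) k
x·-D m zero    = refl
x·-D m (suc k) = refl

x·x·-D : ∀ m k → x· (x· (D m)) k ≡ + shift (shift (d m)) k
x·x·-D m zero          = refl
x·x·-D m (suc zero)    = refl
x·x·-D m (suc (suc k)) = refl

+-rearrangeℤ : ∀ {a b c e f} → a + f ≡ b + (c + e) → + a ≡ + b ℤ.+ (+ c ℤ.+ (+ e ℤ.- + f))
+-rearrangeℤ {a} {b} {c} {e} {f} a+f≡b+c+e = begin
  + a                                  ≡⟨ add-sub (+ a) (+ f) ⟩
  (+ a ℤ.+ + f) ℤ.- + f                ≡⟨ cong (ℤ._- + f) (ℤP.pos-+ a f) ⟨
  + (a + f) ℤ.- + f                    ≡⟨ cong (λ m → + m ℤ.- + f) a+f≡b+c+e ⟩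
  + (b + (c + e)) ℤ.- + f              ≡⟨ cong (ℤ._- + f) (trans (ℤP.pos-+ b _) (cong (ℤ._+_ (+ b)) (ℤP.pos-+ c e))) ⟩
  (+ b ℤ.+ (+ c ℤ.+ + e)) ℤ.- + f      ≡⟨ sub-assoc (+ b) (+ c) (+ e) (+ f) ⟩
  + b ℤ.+ (+ c ℤ.+ (+ e ℤ.- + f))      ∎
  where
  add-sub : ∀ x y → x ≡ (x ℤ.+ y) ℤ.- y
  add-sub = ℤSolver.solve-∀
  sub-assoc : ∀ x y z w → (x ℤ.+ (y ℤ.+ z)) ℤ.- w ≡ x ℤ.+ (y ℤ.+ (z ℤ.- w))
  sub-assoc = ℤSolver.solve-∀

recurrence-6 : ∀ k → D 6 k ≡ (x· (D 5) ⊕ (x· (D 4) ⊕ (x· (D 3) ⊖ x· (x· (D 3))))) k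
recurrence-6 0 = refl
recurrence-6 1 = refl
recurrence-6 2 = refl
recurrence-6 3 = refl
recurrence-6 4 = refl
recurrence-6 5 = refl
recurrence-6 6 = refl
recurrence-6 (suc (suc (suc (suc (suc (suc (suc k))))))) = refl

recurrence-7 : ∀ k → D 7 k ≡ (x· (D 6) ⊕ (x· (D 5) ⊕ (x· (D 4) ⊖ x· (x· (D 4))))) k
recurrence-7 0 = refl
recurrence-7 1 = refl
recurrence-7 2 = refl
recurrence-7 3 = refl
recurrence-7 4 = refl
recurrence-7 5 = refl
recurrence-7 6 = refl
recurrence-7 7 = refl
recurrence-7 (suc (suc (suc (suc (suc (suc (suc (suc k)))))))) = refl

proposition10 : (n : ℕ) → 6 ≤ n → (k : ℕ) →
    D n k ≡ (x· (D (n ∸ 1)) ⊕ (x· (D (n ∸ 2)) ⊕ (x· (D (n ∸ 3)) ⊖ x· (x· (D (n ∸ 3)))))) k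
proposition10 0 () k
proposition10 1 (s≤s ()) k
proposition10 2 (s≤s (s≤s ())) k
proposition10 3 (s≤s (s≤s (s≤s ()))) k
proposition10 4 (s≤s (s≤s (s≤s (s≤s ())))) k
proposition10 5 (s≤s (s≤s (s≤s (s≤s (s≤s ()))))) k
proposition10 6 _ k = recurrence-6 k
proposition10 7 _ k = recurrence-7 k
proposition10 (suc (suc (suc (suc (suc (suc (suc (suc q)))))))) _ k = begin
  + d (8 + q) k
    ≡⟨ +-rearrangeℤ (d-recurrenceℕ q k) ⟩
  + shift (d (7 + q)) k ℤ.+ (+ shift (d (6 + q)) k ℤ.+ (+ shift (d (5 + q)) k ℤ.- + shift (shift (d (5 + q))) k))
    ≡⟨ cong₂ ℤ._+_ (x·-D (7 + q) k) (cong₂ ℤ._+_ (x·-D (6 + q) k) (cong₂ ℤ._-_ (x·-D (5 + q) k) (x·x·-D (5 + q) k))) ⟨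
  (x· (D (7 + q)) ⊕ (x· (D (6 + q)) ⊕ (x· (D (5 + q)) ⊖ x· (x· (D (5 + q)))))) k ∎
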